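{- Let $H$ be a maximal nonhamiltonian graph having a vertex $z$ of degree $3$, and put $F=H-z$. If $u_1$ and $u_2$ are nonadjacent vertices of $F$, then $F+u_1u_2$ has a hamiltonian path with both endvertices in $N_H(z)$.
   Context: All graphs are simple and finite. A graph is hamiltonian if it has a cycle containing all its vertices. A graph $H$ is maximal nonhamiltonian (MNH) if $H$ is not hamiltonian but $H+e$ is hamiltonian for every edge $e$ of the complement $\overline{H}$. $N_H(z)$ is the set of neighbours of $z$ in $H$. -}

module Defs where

open import Data.Nat using (ℕ; zero; suc; _≤_; _+_)
open import Data.Fin using (Fin; toℕ; punchIn; _≟_)
open import Data.Bool using (Bool; true; false; _∨_; _∧_; if_then_else_)
open import Data.List using (List; map; allFin)
open import Data.Nat.ListAction using (sum)
open import Data.Product using (Σ; _×_)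
open import Data.Sum using (_⊎_)
open import Relation.Nullary using (¬_)
open import Relation.Nullary.Decidable using (⌊_⌋)
open import Relation.Binary.PropositionalEquality using (_≡_)
open import Function.Definitions using (Injective)

record Graph (n : ℕ) : Set where
  field
    adj   : Fin n → Fin n → Bool
    sym   : ∀ x y → adj x y ≡ adj y x
    irrefl : ∀ x → adj x x ≡ false
open Graph public

Adj : ∀ {n} → Graph n → Fin n → Fin n → Set
Adj G x y = adj G x y ≡ true

addEdge : ∀ {n} → Graph n → (u v : Fin n) → ¬ u ≡ v → Graph n
addEdge {n} G u v u≢v = record { adj = a ; sym = s ; irrefl = i }
  where
  a : Fin n → Fin n → Bool
  a x y = adj G x y ∨ (⌊ x ≟ u ⌋ ∧ ⌊ y ≟ v ⌋) ∨ (⌊ x ≟ v ⌋ ∧ ⌊ y ≟ u ⌋)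
  open import Data.Bool.Properties using (∨-comm; ∧-comm; ∨-assoc)
  open import Relation.Binary.PropositionalEquality using (cong₂; trans; cong; refl; subst; sym)
  s : ∀ x y → a x y ≡ a y x
  s x y rewrite Graph.sym G x y
              | ∧-comm ⌊ x ≟ u ⌋ ⌊ y ≟ v ⌋
              | ∧-comm ⌊ x ≟ v ⌋ ⌊ y ≟ u ⌋
              = cong (adj G y x ∨_) (∨-comm (⌊ y ≟ v ⌋ ∧ ⌊ x ≟ u ⌋) (⌊ y ≟ u ⌋ ∧ ⌊ x ≟ v ⌋))
  i : ∀ x → a x x ≡ false
  i x with x ≟ u | x ≟ v
  ... | Relation.Nullary.yes refl | Relation.Nullary.yes q = Data.Empty.⊥-elim (u≢v q)
    where import Data.Empty
  ... | Relation.Nullary.yes refl | Relation.Nullary.no _ rewrite Graph.irrefl G x = refl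
  ... | Relation.Nullary.no _ | Relation.Nullary.yes refl rewrite Graph.irrefl G x = refl
  ... | Relation.Nullary.no _ | Relation.Nullary.no _ rewrite Graph.irrefl G x = refl

-- G - z : delete vertex z; the vertices of G - z are Fin n, embedded via punchIn z
deleteVertex : ∀ {n} → Graph (suc n) → Fin (suc n) → Graph n
deleteVertex G z = record
  { adj = λ x y → adj G (punchIn z x) (punchIn z y)
  ; sym = λ x y → Graph.sym G (punchIn z x) (punchIn z y)
  ; irrefl = λ x → Graph.irrefl G (punchIn z x) }

degree : ∀ {n} → Graph n → Fin n → ℕ
degree {n} G z = sum (map (λ v → if adj G z v then 1 else 0) (allFin n))

-- a hamiltonian cycle: an ordering σ of all vertices (σ injective, hence a
-- bijection of Fin n), with at least 3 vertices, consecutive vertices adjacent,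
-- and the last vertex adjacent to the first.
HamCycle : ∀ {n} → Graph n → Set
HamCycle {n} G =
  Σ (Fin n → Fin n) λ σ →
    Injective _≡_ _≡_ σ × 3 ≤ n
    × (∀ i j → suc (toℕ i) ≡ toℕ j → Adj G (σ i) (σ j))
    × (∀ i j → toℕ i ≡ 0 → suc (toℕ j) ≡ n → Adj G (σ j) (σ i))

Hamiltonian : ∀ {n} → Graph n → Set
Hamiltonian G = HamCycle G

MNH : ∀ {n} → Graph n → Set
MNH G = ¬ Hamiltonian G
  × (∀ u v → (u≢v : ¬ u ≡ v) → ¬ Adj G u v → Hamiltonian (addEdge G u v u≢v))

HamPathEndsIn : ∀ {n} → Graph n → (Fin n → Set) → Set
HamPathEndsIn {n} G P =
  Σ (Fin n → Fin n) λ σ →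
    Injective _≡_ _≡_ σ
    × (∀ i j → suc (toℕ i) ≡ toℕ j → Adj G (σ i) (σ j))
    × (∀ i → toℕ i ≡ 0 ⊎ suc (toℕ i) ≡ n → P (σ i))

-- H + u₁u₂ is hamiltonian by maximality, because u₁u₂ is a non-edge of H avoiding z.
-- Rotating a hamiltonian cycle of H + u₁u₂ to start at z and then deleting z leaves a
-- hamiltonian path of (H + u₁u₂) - z = F + u₁u₂ whose endvertices are the two
-- cycle-neighbours of z; these are H-neighbours of z, since the new edge misses z.
module Submission where

open import Defs hiding (sym)
open import Data.Nat using (ℕ; suc; _≤_)
import Data.Nat.Properties as ℕ
open import Data.Fin using (Fin; punchIn; punchOut; toℕ; lower₁; inject₁; _≟_)
open import Data.Fin.Properties
  using (toℕ-injective; toℕ<n; toℕ-lower₁; lower₁-injective; lower₁-inject₁′; toℕ-inject₁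
        ; suc-injective; injective⇒≤; any?; punchIn-injective; punchInᵢ≢i
        ; punchOut-injective; punchIn-punchOut)
open import Data.Fin.Induction using (<-weakInduction)
open import Data.Bool.Properties using (∨-identityʳ)
open import Data.Product using (Σ; ∃; _,_; proj₁)
open import Data.Sum using (_⊎_; inj₁; inj₂)
open import Relation.Nullary using (¬_; yes; no; contradiction)
open import Relation.Nullary.Decidable using (⌊_⌋)
open import Relation.Binary.PropositionalEquality
  using (_≡_; _≢_; refl; sym; trans; cong; subst; subst₂)
open import Function.Base using (_∘_)
open import Function.Definitions using (Injective)

injective⇒surjective : ∀ {n} {f : Fin n → Fin n} → Injective _≡_ _≡_ f →
                       ∀ y → ∃ λ x → f x ≡ y
injective⇒surjective {suc n} {f} f-inj y with any? (λ x → f x ≟ y)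
... | yes found = found
... | no missed = contradiction (injective⇒≤ punchOut∘f-inj) ℕ.1+n≰n
  where
  y≢f : ∀ x → y ≢ f x
  y≢f x y≡fx = missed (x , sym y≡fx)

  punchOut∘f-inj : Injective _≡_ _≡_ (λ x → punchOut (y≢f x))
  punchOut∘f-inj eq = f-inj (punchOut-injective (y≢f _) (y≢f _) eq)

⌊punchIn≟punchIn⌋ : ∀ {n} (z : Fin (suc n)) (a b : Fin n) →
                    ⌊ punchIn z a ≟ punchIn z b ⌋ ≡ ⌊ a ≟ b ⌋
⌊punchIn≟punchIn⌋ z a b with punchIn z a ≟ punchIn z b | a ≟ b
... | yes _  | yes _ = refl
... | no _   | no _  = refl
... | yes eq | no a≢b = contradiction (punchIn-injective z a b eq) a≢b
... | no ne  | yes refl = contradiction refl ne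

deleteVertex-addEdge : ∀ {n} (G : Graph (suc n)) (z : Fin (suc n)) (u v : Fin n)
                       (u≢v : u ≢ v) (pu≢pv : punchIn z u ≢ punchIn z v) (x y : Fin n) →
                       adj (deleteVertex (addEdge G (punchIn z u) (punchIn z v) pu≢pv) z) x y
                         ≡ adj (addEdge (deleteVertex G z) u v u≢v) x y
deleteVertex-addEdge G z u v _ _ x y
  rewrite ⌊punchIn≟punchIn⌋ z x u | ⌊punchIn≟punchIn⌋ z y v
        | ⌊punchIn≟punchIn⌋ z x v | ⌊punchIn≟punchIn⌋ z y u = refl

addEdge-adj-away : ∀ {n} (G : Graph n) {u v : Fin n} (u≢v : u ≢ v) {x y : Fin n} →
                   x ≢ u → x ≢ v → Adj (addEdge G u v u≢v) x y → Adj G x y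
addEdge-adj-away G {u} {v} _ {x} {y} x≢u x≢v xy with x ≟ u | x ≟ v
... | yes x≡u | _       = contradiction x≡u x≢u
... | no _    | yes x≡v = contradiction x≡v x≢v
... | no _    | no _    = trans (sym (∨-identityʳ (adj G x y))) xy

hamPath-mono : ∀ {n} {G G′ : Graph n} {P Q : Fin n → Set} →
               (∀ x y → Adj G x y → Adj G′ x y) → (∀ x → P x → Q x) →
               HamPathEndsIn G P → HamPathEndsIn G′ Q
hamPath-mono G⊆G′ P⊆Q (σ , σ-inj , σ-adj , σ-ends) =
  σ , σ-inj , (λ i j i+1≡j → G⊆G′ _ _ (σ-adj i j i+1≡j)) , (λ i end → P⊆Q _ (σ-ends i end))

module CyclicOrder {m : ℕ} where

  next : Fin (suc m) → Fin (suc m)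
  next i with m ℕ.≟ toℕ i
  ... | yes _   = Fin.zero
  ... | no m≢i = Fin.suc (lower₁ i m≢i)

  next-injective : Injective _≡_ _≡_ next
  next-injective {i} {j} eq with m ℕ.≟ toℕ i | m ℕ.≟ toℕ j
  ... | yes m≡i | yes m≡j = toℕ-injective (trans (sym m≡i) m≡j)
  ... | no _    | no _    = lower₁-injective (suc-injective eq)
  ... | yes _   | no _    with () ← eq
  ... | no _    | yes _   with () ← eq

  next-consecutive : ∀ i j → suc (toℕ i) ≡ toℕ j → next i ≡ j
  next-consecutive i j i+1≡j with m ℕ.≟ toℕ i
  ... | yes m≡i = contradiction (toℕ<n j) (ℕ.<-irrefl (sym (trans (cong suc m≡i) i+1≡j)))
  ... | no m≢i  = toℕ-injective (trans (cong suc (toℕ-lower₁ i m≢i)) i+1≡j)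

  next-last : ∀ i j → toℕ i ≡ 0 → suc (toℕ j) ≡ suc m → next j ≡ i
  next-last Fin.zero j _ j+1≡m+1 with m ℕ.≟ toℕ j
  ... | yes _   = refl
  ... | no m≢j  = contradiction (sym (ℕ.suc-injective j+1≡m+1)) m≢j

  next-inject₁ : ∀ (q : Fin m) → next (inject₁ q) ≡ Fin.suc q
  next-inject₁ q with m ℕ.≟ toℕ (inject₁ q)
  ... | yes m≡q = contradiction (toℕ<n q) (ℕ.<-irrefl (trans (sym (toℕ-inject₁ q)) (sym m≡q)))
  ... | no m≢q  = cong Fin.suc (lower₁-inject₁′ q m≢q)

module _ {m : ℕ} (G : Graph (suc m)) where
  open CyclicOrder

  -- Through the cyclic successor the two adjacency conditions of HamCycle merge into
  -- one, which is preserved by precomposing σ with next.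
  hamCycle-next : ((σ , _) : HamCycle G) → ∀ i → Adj G (σ i) (σ (next i))
  hamCycle-next (σ , _ , _ , consecutive , wrap) i with m ℕ.≟ toℕ i
  ... | yes m≡i = wrap Fin.zero i refl (cong suc (sym m≡i))
  ... | no m≢i  = consecutive i _ (cong suc (sym (toℕ-lower₁ i m≢i)))

  next⇒hamCycle : {σ : Fin (suc m) → Fin (suc m)} → Injective _≡_ _≡_ σ → 3 ≤ suc m →
                  (∀ i → Adj G (σ i) (σ (next i))) → HamCycle G
  next⇒hamCycle {σ} σ-inj 3≤n σ-next =
    σ , σ-inj , 3≤n
      , (λ i j i+1≡j → subst (Adj G (σ i) ∘ σ) (next-consecutive i j i+1≡j) (σ-next i))
      , (λ i j i≡0 j+1≡n → subst (Adj G (σ j) ∘ σ) (next-last i j i≡0 j+1≡n) (σ-next j))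

  rotate : HamCycle G → HamCycle G
  rotate c@(σ , σ-inj , 3≤n , _) =
    next⇒hamCycle (λ eq → next-injective (σ-inj eq)) 3≤n (λ i → hamCycle-next c (next i))

  rotateTo : (c : HamCycle G) (p : Fin (suc m)) →
             Σ (HamCycle G) λ c′ → proj₁ c′ Fin.zero ≡ proj₁ c p
  rotateTo c p = <-weakInduction StartsAt (λ c → c , refl) step p c
    where
    StartsAt : Fin (suc m) → Set
    StartsAt p = (c : HamCycle G) → Σ (HamCycle G) λ c′ → proj₁ c′ Fin.zero ≡ proj₁ c p

    step : ∀ q → StartsAt (inject₁ q) → StartsAt (Fin.suc q)
    step q ih c with ih (rotate c)
    ... | c′ , c′₀≡ = c′ , trans c′₀≡ (cong (proj₁ c) (next-inject₁ q))

  hamCycle-startingAt : HamCycle G → (z : Fin (suc m)) →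
                        Σ (HamCycle G) λ c → proj₁ c Fin.zero ≡ z
  hamCycle-startingAt c@(_ , σ-inj , _) z with injective⇒surjective σ-inj z
  ... | p , σp≡z with rotateTo c p
  ...   | c′ , c′₀≡σp = c′ , trans c′₀≡σp σp≡z

  hamCycle⇒hamPath-deleteVertex :
    HamCycle G → (z : Fin (suc m)) → HamPathEndsIn (deleteVertex G z) (λ x → Adj G z (punchIn z x))
  hamCycle⇒hamPath-deleteVertex c z
    with (σ , σ-inj , _ , consecutive , wrap) , σ₀≡z ← hamCycle-startingAt c z
    = τ , τ-inj , τ-adj , τ-ends
    where
    z≢σ : ∀ i → z ≢ σ (Fin.suc i)
    z≢σ i z≡σi with () ← σ-inj (trans σ₀≡z z≡σi)

    τ : Fin m → Fin m
    τ i = punchOut (z≢σ i)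

    τ-inj : Injective _≡_ _≡_ τ
    τ-inj eq = suc-injective (σ-inj (punchOut-injective (z≢σ _) (z≢σ _) eq))

    punchIn-τ : ∀ i → punchIn z (τ i) ≡ σ (Fin.suc i)
    punchIn-τ i = punchIn-punchOut (z≢σ i)

    τ-adj : ∀ i j → suc (toℕ i) ≡ toℕ j → Adj (deleteVertex G z) (τ i) (τ j)
    τ-adj i j i+1≡j = subst₂ (Adj G) (sym (punchIn-τ i)) (sym (punchIn-τ j))
                        (consecutive (Fin.suc i) (Fin.suc j) (cong suc i+1≡j))

    τ-ends : ∀ i → toℕ i ≡ 0 ⊎ suc (toℕ i) ≡ m → Adj G z (punchIn z (τ i))
    τ-ends i (inj₁ i≡0)   = subst₂ (Adj G) σ₀≡z (sym (punchIn-τ i))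
                              (consecutive Fin.zero (Fin.suc i) (cong suc (sym i≡0)))
    τ-ends i (inj₂ i+1≡m) = trans (Graph.sym G z _) (subst₂ (Adj G) (sym (punchIn-τ i)) σ₀≡z
                              (wrap Fin.zero (Fin.suc i) refl (cong suc i+1≡m)))

lemma8 : (n : ℕ) (H : Graph (suc n)) (z : Fin (suc n))
         → MNH H → degree H z ≡ 3
         → (u₁ u₂ : Fin n) (u₁≢u₂ : ¬ u₁ ≡ u₂)
         → ¬ Adj (deleteVertex H z) u₁ u₂
         → HamPathEndsIn (addEdge (deleteVertex H z) u₁ u₂ u₁≢u₂)
             (λ x → Adj H z (punchIn z x))
lemma8 n H z (_ , maximal) _ u₁ u₂ u₁≢u₂ u₁≁u₂ =
  hamPath-mono {G = deleteVertex H⁺ z} {G′ = F⁺}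
    (λ x y → trans (sym (deleteVertex-addEdge H z u₁ u₂ u₁≢u₂ pu₁≢pu₂ x y)))
    (λ x → addEdge-adj-away H pu₁≢pu₂ {y = punchIn z x} (z≢punchIn u₁) (z≢punchIn u₂))
    (hamCycle⇒hamPath-deleteVertex H⁺ (maximal _ _ pu₁≢pu₂ u₁≁u₂) z)
  where
  pu₁≢pu₂ : punchIn z u₁ ≢ punchIn z u₂
  pu₁≢pu₂ eq = u₁≢u₂ (punchIn-injective z u₁ u₂ eq)

  z≢punchIn : ∀ u → z ≢ punchIn z u
  z≢punchIn u = punchInᵢ≢i z u ∘ sym

  H⁺ : Graph (suc n)
  H⁺ = addEdge H (punchIn z u₁) (punchIn z u₂) pu₁≢pu₂

  F⁺ : Graph n
  F⁺ = addEdge (deleteVertex H z) u₁ u₂ u₁≢u₂
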